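{- Let $\mathcal{P}$ (nonempty) and $\mathcal{N}$ be finite sets of trees with pairwise disjoint state sets such that some LPTS is consistent with $\mathcal{P}$ and $\mathcal{N}$, and let $S_\mathcal{P}=\bigcup_{P\in\mathcal{P}}S_P$. The procedure which, for $k=0,1,2,\dots$ in turn, decides whether there exists a consistent partition of $S_\mathcal{P}$ of size at most $k$ (by deciding satisfiability of a formula of linear rational arithmetic encoding this question) and halts at the first $k$ for which such a partition exists, terminates.
   Context: All probabilities are rationals. $\mathrm{Dist}(S)$: discrete distributions on $S$, $\mathrm{supp}(\mu)=\{s\mid\mu(s)>0\}$. An LPTS is $\langle S,s^0,\alpha,\tau\rangle$, finite $S$, start state $s^0$, finite actions $\alpha$, finite $\tau\subseteq S\times\alpha\times\mathrm{Dist}(S)$; $s\xrightarrow{a}\mu$ means $(s,a,\mu)\in\tau$. A tree is an LPTS whose start state (root) is in the support of no transition distribution and each other state is in the support of exactly one. $\mu_1\sqsubseteq_R\mu_2$ iff there is a weight function $w:S_1\times S_2\to\mathbb{Q}\cap[0,1]$ with row sums $\mu_1$, column sums $\mu_2$ and $w(s_1,s_2)>0\Rightarrow s_1Rs_2$; $R$ is a strong simulation iff $s_1Rs_2$, $s_1\xrightarrow{a}\mu_1$ imply some $s_2\xrightarrow{a}\mu_2$ with $\mu_1\sqsubseteq_R\mu_2$; $L_1\preceq L_2$ iff a strong simulation relates the start states. An LPTS $L$ is consistent with $\mathcal{P}$ and $\mathcal{N}$ iff $P\preceq L$ for all $P\in\mathcal{P}$ and $N\not\preceq L$ for all $N\in\mathcal{N}$.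 A partition $\Pi$ of $S_\mathcal{P}$ must put all roots of trees in $\mathcal{P}$ into one class; $E_\Pi$ is its set of classes, $[s]_\Pi$ the class of $s$, its size is $|E_\Pi|$. The quotient $\mathcal{P}/\Pi$ is the LPTS $\langle E_\Pi,e^0,\alpha,\tau\rangle$ where $e^0$ is the class of the roots, $\alpha=\bigcup_P\alpha_P$, and $(e,a,\mu)\in\tau$ iff there exist $P\in\mathcal{P}$, $(s,a,\mu_p)\in\tau_P$ with $[s]_\Pi=e$ and $\mu(e')=\sum_{s'\in e'}\mu_p(s')$ for all $e'\in E_\Pi$. $\Pi$ is consistent iff $N\not\preceq\mathcal{P}/\Pi$ for all $N\in\mathcal{N}$. -}

module Defs where

open import Data.Nat using (ℕ; zero; suc)
open import Data.Fin using (Fin; zero; suc; _≟_)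
open import Data.Rational using (ℚ; 0ℚ; 1ℚ; _+_; _≤_; _<_)
open import Data.List using (List; allFin; concatMap; map)
open import Data.List.Membership.Propositional using (_∈_)
open import Data.Product using (Σ; ∃; ∃-syntax; _×_; _,_; proj₁; proj₂)
open import Relation.Nullary using (¬_; does)
open import Relation.Binary.PropositionalEquality using (_≡_)
open import Data.Bool using (if_then_else_)

sumFin : ∀ {n} → (Fin n → ℚ) → ℚ
sumFin {zero}  f = 0ℚ
sumFin {suc n} f = f zero + sumFin (λ i → f (suc i))

IsDist : ∀ {n} → (Fin n → ℚ) → Set
IsDist μ = (∀ s → 0ℚ ≤ μ s) × sumFin μ ≡ 1ℚ

InSupp : ∀ {n} → Fin n → (Fin n → ℚ) → Set
InSupp s μ = 0ℚ < μ s

-- States are Fin size; actions are drawn from a global label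
-- set ℕ (so that different LPTSs can share actions); the finite action
-- set α is a list of labels; τ is a finite list of transitions
-- (read as a set: only membership matters).

record Trans (n : ℕ) : Set where
  constructor mkTrans
  field
    src  : Fin n
    act  : ℕ
    dist : Fin n → ℚ
open Trans public

record LPTS : Set where
  constructor mkLPTS
  field
    size  : ℕ
    start : Fin size
    alpha : List ℕ
    trans : List (Trans size)
open LPTS public

IsLPTS : LPTS → Set
IsLPTS L = ∀ t → t ∈ trans L → IsDist (dist t) × act t ∈ alpha L

SameTrans : ∀ {n} → Trans n → Trans n → Set
SameTrans t t' = src t ≡ src t' × act t ≡ act t' × (∀ s → dist t s ≡ dist t' s)

IsTree : LPTS → Set
IsTree L =
  IsLPTS L
  × (∀ t → t ∈ trans L → ¬ InSupp (start L) (dist t))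
  × (∀ s → ¬ (s ≡ start L) →
       (∃[ t ] (t ∈ trans L × InSupp s (dist t)))
       × (∀ t t' → t ∈ trans L → InSupp s (dist t) →
                   t' ∈ trans L → InSupp s (dist t') → SameTrans t t'))

WeightFn : ∀ {n₁ n₂} → (Fin n₁ → Fin n₂ → Set) →
           (Fin n₁ → ℚ) → (Fin n₂ → ℚ) → Set
WeightFn {n₁} {n₂} R μ₁ μ₂ =
  Σ (Fin n₁ → Fin n₂ → ℚ) λ w →
    (∀ s₁ s₂ → 0ℚ ≤ w s₁ s₂ × w s₁ s₂ ≤ 1ℚ)
    × (∀ s₁ → sumFin (λ s₂ → w s₁ s₂) ≡ μ₁ s₁)
    × (∀ s₂ → sumFin (λ s₁ → w s₁ s₂) ≡ μ₂ s₂)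
    × (∀ s₁ s₂ → 0ℚ < w s₁ s₂ → R s₁ s₂)

IsStrongSim : (L₁ L₂ : LPTS) → (Fin (size L₁) → Fin (size L₂) → Set) → Set
IsStrongSim L₁ L₂ R =
  ∀ s₁ s₂ → R s₁ s₂ → ∀ t₁ → t₁ ∈ trans L₁ → src t₁ ≡ s₁ →
    ∃[ t₂ ] (t₂ ∈ trans L₂ × src t₂ ≡ s₂ × act t₂ ≡ act t₁
             × WeightFn R (dist t₁) (dist t₂))

_⪯_ : LPTS → LPTS → Set₁
L₁ ⪯ L₂ = Σ (Fin (size L₁) → Fin (size L₂) → Set) λ R →
            IsStrongSim L₁ L₂ R × R (start L₁) (start L₂)

-- Samples: 𝒫 is a nonempty finite family of trees indexed by
-- Fin (suc p); 𝒩 is a finite family indexed by Fin q.  The state sets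
-- are disjoint by construction (disjoint union below).

Consistent : ∀ {p q} → (Fin p → LPTS) → (Fin q → LPTS) → LPTS → Set₁
Consistent Ps Ns L = (∀ i → Ps i ⪯ L) × (∀ j → ¬ (Ns j ⪯ L))

SP : ∀ {p} → (Fin p → LPTS) → Set
SP {p} Ps = Σ (Fin p) (λ i → Fin (size (Ps i)))

Surjective : ∀ {A : Set} {c} → (A → Fin c) → Set
Surjective {A} f = ∀ e → ∃[ x ] (f x ≡ e)

-- A partition of S_𝒫 with c classes is given by a surjection onto Fin c
-- (the class map s ↦ [s]_Π); all roots lie in one class.
record Partition {p : ℕ} (Ps : Fin p → LPTS) : Set where
  constructor mkPartition
  field
    classes : ℕ
    cls     : SP Ps → Fin classes
    cls-surj : Surjective cls
    roots   : ∀ i j → cls (i , start (Ps i)) ≡ cls (j , start (Ps j))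
open Partition public

quotTrans : ∀ {p} (Ps : Fin (suc p) → LPTS) (Π : Partition Ps) →
            (i : Fin (suc p)) → Trans (size (Ps i)) → Trans (classes Π)
quotTrans Ps Π i t = mkTrans
  (cls Π (i , src t))
  (act t)
  (λ e → sumFin (λ s → if does (cls Π (i , s) ≟ e) then dist t s else 0ℚ))

quotient : ∀ {p} (Ps : Fin (suc p) → LPTS) → Partition Ps → LPTS
quotient {p} Ps Π = mkLPTS
  (classes Π)
  (cls Π (zero , start (Ps zero)))
  (concatMap (λ i → alpha (Ps i)) (allFin (suc p)))
  (concatMap (λ i → map (quotTrans Ps Π i) (trans (Ps i))) (allFin (suc p)))

ConsistentPartition : ∀ {p q} (Ps : Fin (suc p) → LPTS) (Ns : Fin q → LPTS) →
                      Partition Ps → Set₁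
ConsistentPartition Ps Ns Π = ∀ j → ¬ (Ns j ⪯ quotient Ps Π)

-- The partition Π₀ that merges the roots of the trees in 𝒫 and nothing else is
-- always consistent, so the search halts at the latest when k = |E_Π₀|.  Given a
-- consistent L, the union R of simulations Pᵢ ⪯ L (with the merged root related
-- to the start of L only) is a strong simulation 𝒫/Π₀ ⪯ L: since the trees have
-- no transitions into their roots, every weight function for Pᵢ pushes forward
-- along the class map to one for 𝒫/Π₀.  Were some N ⪯ 𝒫/Π₀, transitivity of ⪯
-- (composing weight functions through the middle distribution) would give N ⪯ L.
module Submission where

open import Defs

open import Data.Nat as ℕ using (ℕ; zero; suc; pred)
import Data.Nat.Properties as ℕ
open import Data.Fin using (Fin; zero; suc; _≟_; _↑ˡ_; _↑ʳ_; splitAt; punchOut; punchIn)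
open import Data.Fin.Properties
  using (↑ˡ-injective; ↑ʳ-injective; splitAt-↑ˡ; splitAt-↑ʳ; join-splitAt;
         punchOut-cong; punchOut-injective; punchOut-punchIn; punchInᵢ≢i; suc-injective)
open import Data.Rational using (ℚ; 0ℚ; 1ℚ; _+_; _*_; _≤_; _<_; 1/_; ≢-nonZero; positive; nonNegative)
open import Data.Rational.Properties
  using (+-identityˡ; +-identityʳ; *-identityˡ; *-identityʳ; *-assoc; *-zeroˡ; *-zeroʳ;
         *-inverseˡ; *-inverseʳ; ≤-refl; ≤-reflexive; ≤-trans; ≤-antisym; <⇒≤; <-≤-trans;
         <-irrefl; ≰⇒>; _≤?_; +-mono-≤; +-monoʳ-≤; positive⁻¹; nonNegative⁻¹;
         nonNeg*nonNeg⇒nonNeg; 1/pos⇒pos; +-*-ring)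
  renaming (_≟_ to _≟ℚ_)
open import Algebra.Bundles using (Ring)
import Algebra.Properties.Semiring.Sum (Ring.semiring +-*-ring) as ℚΣ
open import Algebra.Properties.Monoid.Sum ℕ.+-0-monoid using (sum)
open import Data.Bool using (Bool; true; false; if_then_else_)
open import Data.Empty using (⊥; ⊥-elim)
import Data.Empty.Irrelevant as Irrelevant
open import Data.Sum using (_⊎_; inj₁; inj₂)
open import Data.Product using (Σ; ∃; ∃-syntax; _×_; _,_; proj₁; proj₂)
open import Data.Product.Properties using (Σ-≡,≡←≡)
open import Function using (_∘_)
open import Data.List using (allFin; map)
open import Data.List.Relation.Unary.Any using (satisfied)
open import Data.List.Membership.Propositional using (_∈_)
open import Data.List.Membership.Propositional.Properties using (∈-map⁻; ∈-concatMap⁻)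
open import Relation.Binary.Construct.Composition using (_;_)
open import Relation.Binary.PropositionalEquality hiding (trans)
open import Relation.Binary.PropositionalEquality as ≡ using ()
open import Relation.Nullary using (Dec; does; yes; no)
open import Relation.Nullary.Decidable using (decidable-stable)

private
  variable
    n n₁ n₂ n₃ m : ℕ

sumFin-cong : {f g : Fin n → ℚ} → (∀ i → f i ≡ g i) → sumFin f ≡ sumFin g
sumFin-cong {zero}  f≗g = refl
sumFin-cong {suc n} f≗g = cong₂ _+_ (f≗g zero) (sumFin-cong (λ i → f≗g (suc i)))

sumFin≡sum : (f : Fin n → ℚ) → sumFin f ≡ ℚΣ.sum f
sumFin≡sum {zero}  f = refl
sumFin≡sum {suc n} f = cong (f zero +_) (sumFin≡sum (λ i → f (suc i)))

sumFin-zero : ∀ n → sumFin {n} (λ _ → 0ℚ) ≡ 0ℚ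
sumFin-zero n = ≡.trans (sumFin≡sum {n} (λ _ → 0ℚ)) (ℚΣ.sum-replicate-zero n)

sumFin-comm : (f : Fin n → Fin m → ℚ) →
  sumFin (λ i → sumFin (f i)) ≡ sumFin (λ j → sumFin (λ i → f i j))
sumFin-comm f = ≡.trans (sumFin²≡sum² f) (≡.trans (ℚΣ.∑-comm f) (sym (sumFin²≡sum² (λ j i → f i j))))
  where
  sumFin²≡sum² : (g : Fin n₁ → Fin n₂ → ℚ) →
    sumFin (λ i → sumFin (g i)) ≡ ℚΣ.sum (λ i → ℚΣ.sum (g i))
  sumFin²≡sum² g = ≡.trans (sumFin-cong (λ i → sumFin≡sum (g i))) (sumFin≡sum (λ i → ℚΣ.sum (g i)))

sumFin-*ˡ : ∀ x (f : Fin n → ℚ) → sumFin (λ i → x * f i) ≡ x * sumFin f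
sumFin-*ˡ x f = ≡.trans (sumFin≡sum (λ i → x * f i))
  (≡.trans (sym (ℚΣ.*-distribˡ-sum x f)) (cong (x *_) (sym (sumFin≡sum f))))

sumFin-*ʳ : ∀ x (f : Fin n → ℚ) → sumFin (λ i → f i * x) ≡ sumFin f * x
sumFin-*ʳ x f = ≡.trans (sumFin≡sum (λ i → f i * x))
  (≡.trans (sym (ℚΣ.*-distribʳ-sum x f)) (cong (_* x) (sym (sumFin≡sum f))))

sumFin-if : (b : Bool) (f : Fin n → ℚ) →
  sumFin (λ i → if b then f i else 0ℚ) ≡ (if b then sumFin f else 0ℚ)
sumFin-if true  f = refl
sumFin-if {n} false f = sumFin-zero n

sumFin-indicator : (k : Fin n) (x : ℚ) → sumFin (λ i → if does (k ≟ i) then x else 0ℚ) ≡ x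
sumFin-indicator {suc n} zero    x = ≡.trans (cong (x +_) (sumFin-zero n)) (+-identityʳ x)
sumFin-indicator {suc n} (suc k) x = ≡.trans (+-identityˡ _) (sumFin-indicator k x)

sumFin-nonNeg : (f : Fin n → ℚ) → (∀ i → 0ℚ ≤ f i) → 0ℚ ≤ sumFin f
sumFin-nonNeg {zero}  f f≥0 = ≤-refl
sumFin-nonNeg {suc n} f f≥0 =
  ≤-trans (≤-reflexive (sym (+-identityˡ 0ℚ))) (+-mono-≤ (f≥0 zero) (sumFin-nonNeg _ (λ i → f≥0 (suc i))))

≤-sumFin : (f : Fin n → ℚ) → (∀ i → 0ℚ ≤ f i) → ∀ i → f i ≤ sumFin f
≤-sumFin f f≥0 zero =
  ≤-trans (≤-reflexive (sym (+-identityʳ (f zero)))) (+-monoʳ-≤ (f zero) (sumFin-nonNeg _ (λ i → f≥0 (suc i))))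
≤-sumFin f f≥0 (suc i) =
  ≤-trans (≤-reflexive (sym (+-identityˡ (f (suc i))))) (+-mono-≤ (f≥0 zero) (≤-sumFin _ (λ i → f≥0 (suc i)) i))

sumFin-pos⇒pos : (f : Fin n → ℚ) → 0ℚ < sumFin f → ∃[ i ] 0ℚ < f i
sumFin-pos⇒pos {zero}  f 0<0 = ⊥-elim (<-irrefl refl 0<0)
sumFin-pos⇒pos {suc n} f Σf>0 with f zero ≤? 0ℚ | sumFin (λ i → f (suc i)) ≤? 0ℚ
... | no  f₀≰0 | _        = zero , ≰⇒> f₀≰0
... | yes _    | no  Σ≰0  = let i , fᵢ>0 = sumFin-pos⇒pos (λ i → f (suc i)) (≰⇒> Σ≰0) in suc i , fᵢ>0
... | yes f₀≤0 | yes Σ≤0 =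
  ⊥-elim (<-irrefl refl (<-≤-trans Σf>0 (≤-trans (+-mono-≤ f₀≤0 Σ≤0) (≤-reflexive (+-identityˡ 0ℚ)))))

sumFin-nonNeg-≡0 : (f : Fin n → ℚ) → (∀ i → 0ℚ ≤ f i) → sumFin f ≡ 0ℚ → ∀ i → f i ≡ 0ℚ
sumFin-nonNeg-≡0 f f≥0 Σf≡0 i = ≤-antisym (subst (f i ≤_) Σf≡0 (≤-sumFin f f≥0 i)) (f≥0 i)

*-nonNeg : ∀ {x y} → 0ℚ ≤ x → 0ℚ ≤ y → 0ℚ ≤ x * y
*-nonNeg {x} {y} x≥0 y≥0 =
  nonNegative⁻¹ (x * y) {{nonNeg*nonNeg⇒nonNeg x {{nonNegative x≥0}} y {{nonNegative y≥0}}}}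

nonNeg∧≢0⇒pos : ∀ {x} → 0ℚ ≤ x → x ≢ 0ℚ → 0ℚ < x
nonNeg∧≢0⇒pos {x} x≥0 x≢0 with x ≤? 0ℚ
... | yes x≤0 = ⊥-elim (x≢0 (≤-antisym x≤0 x≥0))
... | no  x≰0 = ≰⇒> x≰0

*-pos⇒posˡ : ∀ {x y} → 0ℚ ≤ x → 0ℚ < x * y → 0ℚ < x
*-pos⇒posˡ {y = y} x≥0 xy>0 = nonNeg∧≢0⇒pos x≥0 λ { refl → <-irrefl (sym (*-zeroˡ y)) xy>0 }

*-pos⇒posʳ : ∀ {x y} → 0ℚ ≤ y → 0ℚ < x * y → 0ℚ < y
*-pos⇒posʳ {x = x} y≥0 xy>0 = nonNeg∧≢0⇒pos y≥0 λ { refl → <-irrefl (sym (*-zeroʳ x)) xy>0 }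

-- The reciprocal, extended by 1/0 = 0.
inv₀ : ℚ → ℚ
inv₀ m with m ≟ℚ 0ℚ
... | yes _   = 0ℚ
... | no  m≢0 = (1/ m) {{≢-nonZero m≢0}}

inv₀-nonNeg : ∀ {m} → 0ℚ ≤ m → 0ℚ ≤ inv₀ m
inv₀-nonNeg {m} m≥0 with m ≟ℚ 0ℚ
... | yes _   = ≤-refl
... | no  m≢0 = <⇒≤ (positive⁻¹ _ {{1/pos⇒pos m {{positive (nonNeg∧≢0⇒pos m≥0 m≢0)}}}})

*-inv₀-cancelʳ : ∀ x m → (m ≡ 0ℚ → x ≡ 0ℚ) → x * (inv₀ m * m) ≡ x
*-inv₀-cancelʳ x m m≡0⇒x≡0 with m ≟ℚ 0ℚ
... | yes m≡0 = ≡.trans (cong (x *_) (*-zeroˡ m)) (≡.trans (*-zeroʳ x) (sym (m≡0⇒x≡0 m≡0)))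
... | no  m≢0 = ≡.trans (cong (x *_) (*-inverseˡ m {{≢-nonZero m≢0}})) (*-identityʳ x)

*-inv₀-cancelˡ : ∀ m y → (m ≡ 0ℚ → y ≡ 0ℚ) → m * (inv₀ m * y) ≡ y
*-inv₀-cancelˡ m y m≡0⇒y≡0 with m ≟ℚ 0ℚ
... | yes m≡0 = ≡.trans (cong (m *_) (*-zeroˡ y)) (≡.trans (*-zeroʳ m) (sym (m≡0⇒y≡0 m≡0)))
... | no  m≢0 = begin
  m * ((1/ m) {{_}} * y) ≡⟨ sym (*-assoc m _ y) ⟩
  (m * (1/ m) {{_}}) * y ≡⟨ cong (_* y) (*-inverseʳ m {{≢-nonZero m≢0}}) ⟩
  1ℚ * y                 ≡⟨ *-identityˡ y ⟩
  y                      ∎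
  where open ≡-Reasoning

private
  variable
    R : Fin n₁ → Fin n₂ → Set
    μ₁ μ₂ : Fin n → ℚ

dist≤1 : ∀ {L} → IsLPTS L → ∀ {t} → t ∈ trans L → ∀ s → dist t s ≤ 1ℚ
dist≤1 isL {t} t∈L s =
  let dist≥0 , Σdist≡1 = proj₁ (isL t t∈L)
  in ≤-trans (≤-sumFin (dist t) dist≥0 s) (≤-reflexive Σdist≡1)

mkWeightFn : (w : Fin n₁ → Fin n₂ → ℚ) → (∀ s₁ s₂ → 0ℚ ≤ w s₁ s₂) →
  (∀ s₁ → sumFin (w s₁) ≡ μ₁ s₁) → (∀ s₂ → sumFin (λ s₁ → w s₁ s₂) ≡ μ₂ s₂) →
  (∀ s₁ s₂ → 0ℚ < w s₁ s₂ → R s₁ s₂) → (∀ s₂ → μ₂ s₂ ≤ 1ℚ) → WeightFn R μ₁ μ₂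
mkWeightFn {μ₂ = μ₂} w w≥0 rows cols rel μ₂≤1 = w , bounds , rows , cols , rel
  where
  bounds : ∀ s₁ s₂ → 0ℚ ≤ w s₁ s₂ × w s₁ s₂ ≤ 1ℚ
  bounds s₁ s₂ = w≥0 s₁ s₂ ,
    ≤-trans (≤-sumFin (λ s → w s s₂) (λ s → w≥0 s s₂) s₁) (≤-trans (≤-reflexive (cols s₂)) (μ₂≤1 s₂))

WeightFn-support : (W : WeightFn R μ₁ μ₂) → ∀ {s₁ s₂} → 0ℚ < proj₁ W s₁ s₂ → 0ℚ < μ₁ s₁
WeightFn-support (w , bounds , rows , _) {s₁} {s₂} w>0 =
  <-≤-trans w>0 (≤-trans (≤-sumFin (w s₁) (λ s → proj₁ (bounds s₁ s)) s₂) (≤-reflexive (rows s₁)))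

-- Weight functions for μ₁ ⊑ μ₂ and μ₂ ⊑ μ₃ are glued along μ₂:
-- (glue w μ₂ w') s₁ s₃ = Σ_{s₂} w s₁ s₂ · w' s₂ s₃ / μ₂ s₂.
glue : (Fin n₁ → Fin n₂ → ℚ) → (Fin n₂ → ℚ) → (Fin n₂ → Fin n₃ → ℚ) → Fin n₁ → Fin n₃ → ℚ
glue w μ w' s₁ s₃ = sumFin (λ s₂ → w s₁ s₂ * (inv₀ (μ s₂) * w' s₂ s₃))

glue-rows : (w : Fin n₁ → Fin n₂ → ℚ) (μ : Fin n₂ → ℚ) (w' : Fin n₂ → Fin n₃ → ℚ) →
  (∀ s₂ → sumFin (w' s₂) ≡ μ s₂) → (∀ s₁ s₂ → μ s₂ ≡ 0ℚ → w s₁ s₂ ≡ 0ℚ) →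
  ∀ s₁ → sumFin (glue w μ w' s₁) ≡ sumFin (w s₁)
glue-rows w μ w' rows' μ≡0⇒w≡0 s₁ = begin
  sumFin (λ s₃ → sumFin (λ s₂ → w s₁ s₂ * (inv₀ (μ s₂) * w' s₂ s₃)))
    ≡⟨ sym (sumFin-comm (λ s₂ s₃ → w s₁ s₂ * (inv₀ (μ s₂) * w' s₂ s₃))) ⟩
  sumFin (λ s₂ → sumFin (λ s₃ → w s₁ s₂ * (inv₀ (μ s₂) * w' s₂ s₃)))
    ≡⟨ sumFin-cong (λ s₂ → ≡.trans (sumFin-*ˡ (w s₁ s₂) (λ s₃ → inv₀ (μ s₂) * w' s₂ s₃))
                                   (cong (w s₁ s₂ *_) (sumFin-*ˡ (inv₀ (μ s₂)) (w' s₂)))) ⟩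
  sumFin (λ s₂ → w s₁ s₂ * (inv₀ (μ s₂) * sumFin (w' s₂)))
    ≡⟨ sumFin-cong (λ s₂ → cong (λ x → w s₁ s₂ * (inv₀ (μ s₂) * x)) (rows' s₂)) ⟩
  sumFin (λ s₂ → w s₁ s₂ * (inv₀ (μ s₂) * μ s₂))
    ≡⟨ sumFin-cong (λ s₂ → *-inv₀-cancelʳ (w s₁ s₂) (μ s₂) (μ≡0⇒w≡0 s₁ s₂)) ⟩
  sumFin (w s₁) ∎
  where open ≡-Reasoning

glue-cols : (w : Fin n₁ → Fin n₂ → ℚ) (μ : Fin n₂ → ℚ) (w' : Fin n₂ → Fin n₃ → ℚ) →
  (∀ s₂ → sumFin (λ s₁ → w s₁ s₂) ≡ μ s₂) → (∀ s₂ s₃ → μ s₂ ≡ 0ℚ → w' s₂ s₃ ≡ 0ℚ) →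
  ∀ s₃ → sumFin (λ s₁ → glue w μ w' s₁ s₃) ≡ sumFin (λ s₂ → w' s₂ s₃)
glue-cols w μ w' cols μ≡0⇒w'≡0 s₃ = begin
  sumFin (λ s₁ → sumFin (λ s₂ → w s₁ s₂ * (inv₀ (μ s₂) * w' s₂ s₃)))
    ≡⟨ sumFin-comm (λ s₁ s₂ → w s₁ s₂ * (inv₀ (μ s₂) * w' s₂ s₃)) ⟩
  sumFin (λ s₂ → sumFin (λ s₁ → w s₁ s₂ * (inv₀ (μ s₂) * w' s₂ s₃)))
    ≡⟨ sumFin-cong (λ s₂ → sumFin-*ʳ (inv₀ (μ s₂) * w' s₂ s₃) (λ s₁ → w s₁ s₂)) ⟩
  sumFin (λ s₂ → sumFin (λ s₁ → w s₁ s₂) * (inv₀ (μ s₂) * w' s₂ s₃))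
    ≡⟨ sumFin-cong (λ s₂ → cong (_* (inv₀ (μ s₂) * w' s₂ s₃)) (cols s₂)) ⟩
  sumFin (λ s₂ → μ s₂ * (inv₀ (μ s₂) * w' s₂ s₃))
    ≡⟨ sumFin-cong (λ s₂ → *-inv₀-cancelˡ (μ s₂) (w' s₂ s₃) (μ≡0⇒w'≡0 s₂ s₃)) ⟩
  sumFin (λ s₂ → w' s₂ s₃) ∎
  where open ≡-Reasoning

WeightFn-∘ : {R : Fin n₁ → Fin n₂ → Set} {R' : Fin n₂ → Fin n₃ → Set}
  {μ₁ : Fin n₁ → ℚ} {μ₂ : Fin n₂ → ℚ} {μ₃ : Fin n₃ → ℚ} → (∀ s₃ → μ₃ s₃ ≤ 1ℚ) →
  WeightFn R μ₁ μ₂ → WeightFn R' μ₂ μ₃ → WeightFn (R ; R') μ₁ μ₃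
WeightFn-∘ {R = R} {R'} {μ₁} {μ₂} {μ₃} μ₃≤1
  (w , w-bounds , w-rows , w-cols , w-rel) (w' , w'-bounds , w'-rows , w'-cols , w'-rel) =
  mkWeightFn (glue w μ₂ w') glue≥0
    (λ s₁ → ≡.trans (glue-rows w μ₂ w' w'-rows μ₂≡0⇒w≡0 s₁) (w-rows s₁))
    (λ s₃ → ≡.trans (glue-cols w μ₂ w' w-cols μ₂≡0⇒w'≡0 s₃) (w'-cols s₃))
    rel μ₃≤1
  where
  w≥0 : ∀ s₁ s₂ → 0ℚ ≤ w s₁ s₂
  w≥0 s₁ s₂ = proj₁ (w-bounds s₁ s₂)
  w'≥0 : ∀ s₂ s₃ → 0ℚ ≤ w' s₂ s₃
  w'≥0 s₂ s₃ = proj₁ (w'-bounds s₂ s₃)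
  μ₂≡0⇒w≡0 : ∀ s₁ s₂ → μ₂ s₂ ≡ 0ℚ → w s₁ s₂ ≡ 0ℚ
  μ₂≡0⇒w≡0 s₁ s₂ μ₂≡0 = sumFin-nonNeg-≡0 (λ s → w s s₂) (λ s → w≥0 s s₂) (≡.trans (w-cols s₂) μ₂≡0) s₁
  μ₂≡0⇒w'≡0 : ∀ s₂ s₃ → μ₂ s₂ ≡ 0ℚ → w' s₂ s₃ ≡ 0ℚ
  μ₂≡0⇒w'≡0 s₂ s₃ μ₂≡0 = sumFin-nonNeg-≡0 (w' s₂) (w'≥0 s₂) (≡.trans (w'-rows s₂) μ₂≡0) s₃
  inv₀μ₂w'≥0 : ∀ s₂ s₃ → 0ℚ ≤ inv₀ (μ₂ s₂) * w' s₂ s₃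
  inv₀μ₂w'≥0 s₂ s₃ = *-nonNeg
    (inv₀-nonNeg (subst (0ℚ ≤_) (w-cols s₂) (sumFin-nonNeg (λ s₁ → w s₁ s₂) (λ s₁ → w≥0 s₁ s₂))))
    (w'≥0 s₂ s₃)
  glue≥0 : ∀ s₁ s₃ → 0ℚ ≤ glue w μ₂ w' s₁ s₃
  glue≥0 s₁ s₃ = sumFin-nonNeg _ (λ s₂ → *-nonNeg (w≥0 s₁ s₂) (inv₀μ₂w'≥0 s₂ s₃))
  rel : ∀ s₁ s₃ → 0ℚ < glue w μ₂ w' s₁ s₃ → (R ; R') s₁ s₃
  rel s₁ s₃ glue>0 =
    let s₂ , term>0 = sumFin-pos⇒pos (λ s₂ → w s₁ s₂ * (inv₀ (μ₂ s₂) * w' s₂ s₃)) glue>0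
        inv₀w'>0 = *-pos⇒posʳ {w s₁ s₂} (inv₀μ₂w'≥0 s₂ s₃) term>0
    in s₂ , w-rel s₁ s₂ (*-pos⇒posˡ (w≥0 s₁ s₂) term>0)
          , w'-rel s₂ s₃ (*-pos⇒posʳ {inv₀ (μ₂ s₂)} (w'≥0 s₂ s₃) inv₀w'>0)

pushforward : (Fin n → Fin m) → (Fin n → ℚ) → Fin m → ℚ
pushforward f μ e = sumFin (λ s → if does (f s ≟ e) then μ s else 0ℚ)

sumFin-pushforward : (f : Fin n → Fin m) (μ : Fin n → ℚ) → sumFin (pushforward f μ) ≡ sumFin μ
sumFin-pushforward f μ = ≡.trans (sumFin-comm (λ e s → if does (f s ≟ e) then μ s else 0ℚ))
  (sumFin-cong (λ s → sumFin-indicator (f s) (μ s)))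

pushforward-nonNeg : (f : Fin n → Fin m) {μ : Fin n → ℚ} → (∀ s → 0ℚ ≤ μ s) → ∀ e → 0ℚ ≤ pushforward f μ e
pushforward-nonNeg f {μ} μ≥0 e = sumFin-nonNeg _ λ s → if-nonNeg (does (f s ≟ e)) (μ≥0 s)
  where
  if-nonNeg : ∀ b {x} → 0ℚ ≤ x → 0ℚ ≤ (if b then x else 0ℚ)
  if-nonNeg true  x≥0 = x≥0
  if-nonNeg false _   = ≤-refl

pushforward-pos⇒pos : (f : Fin n → Fin m) (μ : Fin n → ℚ) → ∀ e → 0ℚ < pushforward f μ e →
  ∃[ s ] (f s ≡ e × 0ℚ < μ s)
pushforward-pos⇒pos f μ e μ*>0 with sumFin-pos⇒pos _ μ*>0
... | s , term>0 with f s ≟ e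
...   | yes fs≡e = s , fs≡e , term>0
...   | no  _    = ⊥-elim (<-irrefl refl term>0)

WeightFn-pushforward : {R : Fin n₁ → Fin n₂ → Set} {R' : Fin m → Fin n₂ → Set} {μ₁ : Fin n₁ → ℚ}
  {μ₂ : Fin n₂ → ℚ} (f : Fin n₁ → Fin m) → (∀ s₂ → μ₂ s₂ ≤ 1ℚ) →
  (∀ s₁ s₂ → 0ℚ < μ₁ s₁ → R s₁ s₂ → R' (f s₁) s₂) →
  WeightFn R μ₁ μ₂ → WeightFn R' (pushforward f μ₁) μ₂
WeightFn-pushforward {R = R} {R'} {μ₁} {μ₂} f μ₂≤1 R⇒R' W@(w , bounds , rows , cols , rel) =
  mkWeightFn w* w*≥0 rows* cols* rel* μ₂≤1
  where
  w* : ∀ e s₂ → ℚ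
  w* e s₂ = pushforward f (λ s₁ → w s₁ s₂) e
  w*≥0 : ∀ e s₂ → 0ℚ ≤ w* e s₂
  w*≥0 e s₂ = pushforward-nonNeg f (λ s₁ → proj₁ (bounds s₁ s₂)) e
  rows* : ∀ e → sumFin (w* e) ≡ pushforward f μ₁ e
  rows* e = ≡.trans (sym (sumFin-comm (λ s₁ s₂ → if does (f s₁ ≟ e) then w s₁ s₂ else 0ℚ)))
    (sumFin-cong (λ s₁ → ≡.trans (sumFin-if (does (f s₁ ≟ e)) (w s₁))
                                 (cong (λ x → if does (f s₁ ≟ e) then x else 0ℚ) (rows s₁))))
  cols* : ∀ s₂ → sumFin (λ e → w* e s₂) ≡ μ₂ s₂
  cols* s₂ = ≡.trans (sumFin-pushforward f (λ s₁ → w s₁ s₂)) (cols s₂)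
  rel* : ∀ e s₂ → 0ℚ < w* e s₂ → R' e s₂
  rel* e s₂ w*>0 with pushforward-pos⇒pos f (λ s₁ → w s₁ s₂) e w*>0
  ... | s₁ , refl , w>0 = R⇒R' s₁ s₂ (WeightFn-support W w>0) (rel s₁ s₂ w>0)

⪯-trans : ∀ {L₁ L₂ L₃} → IsLPTS L₃ → L₁ ⪯ L₂ → L₂ ⪯ L₃ → L₁ ⪯ L₃
⪯-trans {L₁} {L₂} {L₃} isL₃ (R , R-sim , R-start) (R' , R'-sim , R'-start) =
  (R ; R') , sim , (start L₂ , R-start , R'-start)
  where
  sim : IsStrongSim L₁ L₃ (R ; R')
  sim s₁ s₃ (s₂ , s₁Rs₂ , s₂R's₃) t₁ t₁∈L₁ src₁ with R-sim s₁ s₂ s₁Rs₂ t₁ t₁∈L₁ src₁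
  ... | t₂ , t₂∈L₂ , src₂ , act₂ , W with R'-sim s₂ s₃ s₂R's₃ t₂ t₂∈L₂ src₂
  ...   | t₃ , t₃∈L₃ , src₃ , act₃ , W' =
    t₃ , t₃∈L₃ , src₃ , ≡.trans act₃ act₂ , WeightFn-∘ (dist≤1 {L₃} isL₃ t₃∈L₃) W W'

module _ {p} (Ps : Fin (suc p) → LPTS) (Π : Partition Ps) where

  MergesOnlyRoots : Set
  MergesOnlyRoots = ∀ {i s j s'} → start (Ps i) ≢ s → cls Π (i , s) ≡ cls Π (j , s') →
    _≡_ {A = SP Ps} (i , s) (j , s')

  quotient-trans⁻ : ∀ {t} → t ∈ trans (quotient Ps Π) →
    ∃[ i ] ∃[ t' ] (t' ∈ trans (Ps i) × t ≡ quotTrans Ps Π i t')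
  quotient-trans⁻ t∈Q
    with satisfied (∈-concatMap⁻ (λ i → map (quotTrans Ps Π i) (trans (Ps i))) {xs = allFin (suc p)} t∈Q)
  ... | i , t∈Qᵢ with ∈-map⁻ (quotTrans Ps Π i) t∈Qᵢ
  ...   | t' , t'∈Pᵢ , t≡ = i , t' , t'∈Pᵢ , t≡

  module _ (merges : MergesOnlyRoots) (trees : ∀ i → IsTree (Ps i))
           {L : LPTS} (sims : ∀ i → Ps i ⪯ L) where

    private
      rootClass : Fin (classes Π)
      rootClass = cls Π (zero , start (Ps zero))

      Rᵢ : ∀ i → Fin (size (Ps i)) → Fin (size L) → Set
      Rᵢ i = proj₁ (sims i)

    -- The merged root is related only to the start of L: the simulations Pᵢ ⪯ L
    -- may relate the various roots to different states of L.
    R/Π : Fin (classes Π) → Fin (size L) → Set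
    R/Π e l = (e ≡ rootClass × l ≡ start L)
            ⊎ ∃[ i ] ∃[ s ] (start (Ps i) ≢ s × cls Π (i , s) ≡ e × Rᵢ i s l)

    rootClass⇒root : ∀ {i s} → cls Π (i , s) ≡ rootClass → start (Ps i) ≡ s
    rootClass⇒root {i} {s} cls≡root = decidable-stable (start (Ps i) ≟ s) λ root≢s →
      root≢root (merges root≢s cls≡root) root≢s
      where
      root≢root : ∀ {j s'} → _≡_ {A = SP Ps} (j , s') (zero , start (Ps zero)) → start (Ps j) ≢ s' → ⊥
      root≢root refl root≢s' = root≢s' refl

    R/Π⇒Rᵢ : ∀ {i s l} → R/Π (cls Π (i , s)) l → Rᵢ i s l
    R/Π⇒Rᵢ {i} (inj₁ (cls≡root , refl)) =
      subst (λ s → Rᵢ i s (start L)) (rootClass⇒root cls≡root) (proj₂ (proj₂ (sims i)))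
    R/Π⇒Rᵢ (inj₂ (j , s' , root≢s' , cls≡cls , s'Rl)) with merges root≢s' cls≡cls
    ... | refl = s'Rl

    support⇒R/Π : ∀ {i t s l} → t ∈ trans (Ps i) → 0ℚ < dist t s → Rᵢ i s l → R/Π (cls Π (i , s)) l
    support⇒R/Π {i} {t} {s} t∈Pᵢ s∈supp sRl = inj₂ (i , s , root≢s , refl , sRl)
      where
      root≢s : start (Ps i) ≢ s
      root≢s refl = proj₁ (proj₂ (trees i)) t t∈Pᵢ s∈supp

    quotient-⪯ : IsLPTS L → quotient Ps Π ⪯ L
    quotient-⪯ isL = R/Π , sim , inj₁ (refl , refl)
      where
      sim : IsStrongSim (quotient Ps Π) L R/Π
      sim e l eR/Πl t t∈Q src≡e with quotient-trans⁻ t∈Q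
      ... | i , t' , t'∈Pᵢ , refl
        with proj₁ (proj₂ (sims i)) (src t') l (R/Π⇒Rᵢ (subst (λ e → R/Π e l) (sym src≡e) eR/Πl)) t' t'∈Pᵢ refl
      ... | t₂ , t₂∈L , src₂ , act₂ , W =
        t₂ , t₂∈L , src₂ , act₂ ,
        WeightFn-pushforward (λ s → cls Π (i , s)) (dist≤1 {L} isL t₂∈L)
          (λ s _ s∈supp → support⇒R/Π t'∈Pᵢ s∈supp) W

-- Irrelevance of the proof makes punchOut′ r s independent of which proof of r ≢ s is supplied.
punchOut′ : (r s : Fin n) → .(r ≢ s) → Fin (pred n)
punchOut′ {suc n} r s r≢s = punchOut {i = r} {j = s} (λ r≡s → Irrelevant.⊥-elim (r≢s r≡s))

punchOut′-injective : ∀ (r : Fin n) {s s'} (r≢s : r ≢ s) (r≢s' : r ≢ s') →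
  punchOut′ r s r≢s ≡ punchOut′ r s' r≢s' → s ≡ s'
punchOut′-injective {suc n} r r≢s r≢s' = punchOut-injective {i = r} _ _

punchOut′-surjective : ∀ (r : Fin n) x → ∃[ s ] Σ (r ≢ s) λ r≢s → punchOut′ r s r≢s ≡ x
punchOut′-surjective {suc n} r x =
  punchIn r x , punchInᵢ≢i r x ∘ sym , ≡.trans (punchOut-cong r refl) (punchOut-punchIn r)

flatten : ∀ {k} (n : Fin k → ℕ) (i : Fin k) → Fin (n i) → Fin (sum n)
flatten n zero    x = x ↑ˡ sum (λ i → n (suc i))
flatten n (suc i) x = n zero ↑ʳ flatten (λ i → n (suc i)) i x

flatten-injective : ∀ {k} (n : Fin k → ℕ) {i j x y} → flatten n i x ≡ flatten n j y →
  _≡_ {A = Σ (Fin k) (λ i → Fin (n i))} (i , x) (j , y)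
flatten-injective n {zero} {zero} {x} {y} eq = cong (zero ,_) (↑ˡ-injective _ x y eq)
flatten-injective n {zero} {suc j} {x} eq
  with ≡.trans (sym (splitAt-↑ˡ (n zero) x _)) (≡.trans (cong (splitAt (n zero)) eq) (splitAt-↑ʳ (n zero) _ _))
... | ()
flatten-injective n {suc i} {zero} {y = y} eq
  with ≡.trans (sym (splitAt-↑ˡ (n zero) y _)) (≡.trans (cong (splitAt (n zero)) (sym eq)) (splitAt-↑ʳ (n zero) _ _))
... | ()
flatten-injective n {suc i} {suc j} {x} {y} eq
  with flatten-injective (λ i → n (suc i)) {i} {j} {x} {y} (↑ʳ-injective (n zero) _ _ eq)
... | refl = refl

flatten-surjective : ∀ {k} (n : Fin k → ℕ) y → ∃[ i ] ∃[ x ] flatten n i x ≡ y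
flatten-surjective {suc k} n y with splitAt (n zero) y | join-splitAt (n zero) (sum (λ i → n (suc i))) y
... | inj₁ x | join≡y = zero , x , join≡y
... | inj₂ z | join≡y with flatten-surjective (λ i → n (suc i)) z
...   | i , x , flatten≡z = suc i , x , ≡.trans (cong (n zero ↑ʳ_) flatten≡z) join≡y

module _ {p} (Ps : Fin (suc p) → LPTS) where

  nonRoots : Fin (suc p) → ℕ
  nonRoots i = pred (size (Ps i))

  flattenNonRoot : ∀ i s → start (Ps i) ≢ s → Fin (sum nonRoots)
  flattenNonRoot i s root≢s = flatten nonRoots i (punchOut′ (start (Ps i)) s root≢s)

  rootMergingClass : SP Ps → Fin (suc (sum nonRoots))
  rootMergingClass (i , s) with start (Ps i) ≟ s
  ... | yes _      = zero
  ... | no root≢s = suc (flattenNonRoot i s root≢s)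

  rootMergingClass-root : ∀ i → rootMergingClass (i , start (Ps i)) ≡ zero
  rootMergingClass-root i with start (Ps i) ≟ start (Ps i)
  ... | yes _      = refl
  ... | no root≢s = ⊥-elim (root≢s refl)

  rootMergingClass-nonRoot : ∀ {i s} (root≢s : start (Ps i) ≢ s) →
    rootMergingClass (i , s) ≡ suc (flattenNonRoot i s root≢s)
  rootMergingClass-nonRoot {i} {s} root≢s with start (Ps i) ≟ s
  ... | yes root≡s = ⊥-elim (root≢s root≡s)
  ... | no  _      = refl

  rootMergingClass-surjective : Surjective rootMergingClass
  rootMergingClass-surjective zero    = (zero , start (Ps zero)) , rootMergingClass-root zero
  rootMergingClass-surjective (suc y) with flatten-surjective nonRoots y
  ... | i , x , flatten≡y with punchOut′-surjective (start (Ps i)) x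
  ...   | s , root≢s , punchOut≡x =
    (i , s) , ≡.trans (rootMergingClass-nonRoot root≢s)
                      (cong suc (≡.trans (cong (flatten nonRoots i) punchOut≡x) flatten≡y))

  rootMergingPartition : Partition Ps
  rootMergingPartition = mkPartition (suc (sum nonRoots)) rootMergingClass rootMergingClass-surjective
    (λ i j → ≡.trans (rootMergingClass-root i) (sym (rootMergingClass-root j)))

  flattenNonRoot-injective : ∀ {i s j s'} (root≢s : start (Ps i) ≢ s) (root≢s' : start (Ps j) ≢ s') →
    flattenNonRoot i s root≢s ≡ flattenNonRoot j s' root≢s' → _≡_ {A = SP Ps} (i , s) (j , s')
  flattenNonRoot-injective {i} {s} {j} {s'} root≢s root≢s' eq
    with Σ-≡,≡←≡ (flatten-injective nonRoots {i} {j} eq)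
  ... | refl , punchOut≡punchOut =
    cong (i ,_) (punchOut′-injective (start (Ps i)) root≢s root≢s' punchOut≡punchOut)

  rootMergingPartition-mergesOnlyRoots : MergesOnlyRoots Ps rootMergingPartition
  rootMergingPartition-mergesOnlyRoots {i} {s} {j} {s'} root≢s cls≡cls = from-dec (start (Ps j) ≟ s')
    where
    suc≡cls : suc (flattenNonRoot i s root≢s) ≡ rootMergingClass (j , s')
    suc≡cls = ≡.trans (sym (rootMergingClass-nonRoot root≢s)) cls≡cls
    from-dec : Dec (start (Ps j) ≡ s') → _≡_ {A = SP Ps} (i , s) (j , s')
    from-dec (yes refl) with () ← ≡.trans suc≡cls (rootMergingClass-root j)
    from-dec (no root≢s') =
      flattenNonRoot-injective root≢s root≢s' (suc-injective (≡.trans suc≡cls (rootMergingClass-nonRoot root≢s')))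

theorem2 : (p q : ℕ) (Ps : Fin (suc p) → LPTS) (Ns : Fin q → LPTS) →
    (∀ i → IsTree (Ps i)) → (∀ j → IsTree (Ns j)) →
    (Σ LPTS λ L → IsLPTS L × Consistent Ps Ns L) →
    ∃[ k ] Σ (Partition Ps) λ Π → classes Π ℕ.≤ k × ConsistentPartition Ps Ns Π
theorem2 p q Ps Ns trees _ (L , isL , Ps⪯L , Ns⋠L) = classes Π₀ , Π₀ , ℕ.≤-refl , Π₀-consistent
  where
  Π₀ : Partition Ps
  Π₀ = rootMergingPartition Ps
  Ps/Π₀⪯L : quotient Ps Π₀ ⪯ L
  Ps/Π₀⪯L = quotient-⪯ Ps Π₀ (rootMergingPartition-mergesOnlyRoots Ps) trees Ps⪯L isL
  Π₀-consistent : ConsistentPartition Ps Ns Π₀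
  Π₀-consistent j N⪯Ps/Π₀ = Ns⋠L j (⪯-trans {Ns j} {quotient Ps Π₀} {L} isL N⪯Ps/Π₀ Ps/Π₀⪯L)
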